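{- If $n$ is a positive integer satisfying $$\frac{2n}{n + 1} \leq \frac{\sigma(n)}{n} < \frac{2n + 1}{n + 1},$$ then $\sigma(n) = 2n - 1$.
   Context: $\sigma(n)$ denotes the sum of all positive divisors of $n$. -}

module Defs where

open import Data.Nat using (ℕ; suc)
open import Data.Nat.Divisibility using (_∣?_)
open import Data.List using (List; filter; upTo; map)
open import Data.Nat.ListAction using (sum)

divisors : ℕ → List ℕ
divisors n = filter (_∣? n) (map suc (upTo n))

σ : ℕ → ℕ
σ n = sum (divisors n)

-- Clearing denominators, the hypotheses say 2n² ≤ σ(n)(n+1) < 2n² + n.
-- Since (2n−2)(n+1) = 2n² − 2 and 2n(n+1) = 2n² + 2n, this squeezes σ(n)
-- strictly between 2n − 2 and 2n. Nothing about σ beyond being a natural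
-- number is used.
module Submission where

open import Defs
open import Data.Nat as ℕ using (ℕ; suc)
open import Data.Nat.Properties as ℕ
  using (≤-antisym; *-cancelʳ-<; *-suc; m<n+m; m≤m+n; module ≤-Reasoning)
open import Data.Nat.Tactic.RingSolver using (solve-∀)
open import Data.Integer as ℤ using (ℤ; +_)
open import Data.Integer.Properties using (pos-*; drop‿+≤+; drop‿+<+)
open import Data.Rational using (_/_; _≤_; _<_)
open import Data.Rational.Properties using (toℚᵘ-mono-≤; toℚᵘ-mono-<; toℚᵘ-fromℚᵘ)
open import Data.Rational.Unnormalised using (mkℚᵘ; *≤*; *<*)
open import Data.Rational.Unnormalised.Properties
  using (≤-respˡ-≃; ≤-respʳ-≃; <-respˡ-≃; <-respʳ-≃)
open import Relation.Binary.PropositionalEquality using (_≡_; sym; subst₂; cong)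
open ≤-Reasoning

-- i / suc c is the reduced fraction; toℚᵘ-fromℚᵘ identifies it with mkℚᵘ i c up to ≃.
/-≤⇒*-≤ : ∀ (i j : ℤ) c d → i / suc c ≤ j / suc d → i ℤ.* + suc d ℤ.≤ j ℤ.* + suc c
/-≤⇒*-≤ i j c d i/c≤j/d
  with ≤-respʳ-≃ (toℚᵘ-fromℚᵘ (mkℚᵘ j d))
         (≤-respˡ-≃ (toℚᵘ-fromℚᵘ (mkℚᵘ i c)) (toℚᵘ-mono-≤ i/c≤j/d))
... | *≤* id≤jc = id≤jc

/-<⇒*-< : ∀ (i j : ℤ) c d → i / suc c < j / suc d → i ℤ.* + suc d ℤ.< j ℤ.* + suc c
/-<⇒*-< i j c d i/c<j/d
  with <-respʳ-≃ (toℚᵘ-fromℚᵘ (mkℚᵘ j d))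
         (<-respˡ-≃ (toℚᵘ-fromℚᵘ (mkℚᵘ i c)) (toℚᵘ-mono-< i/c<j/d))
... | *<* id<jc = id<jc

+/-≤⇒*-≤ : ∀ a b c d → + a / suc c ≤ + b / suc d → a ℕ.* suc d ℕ.≤ b ℕ.* suc c
+/-≤⇒*-≤ a b c d le =
  drop‿+≤+ (subst₂ ℤ._≤_ (sym (pos-* a (suc d))) (sym (pos-* b (suc c)))
    (/-≤⇒*-≤ (+ a) (+ b) c d le))

+/-<⇒*-< : ∀ a b c d → + a / suc c < + b / suc d → a ℕ.* suc d ℕ.< b ℕ.* suc c
+/-<⇒*-< a b c d lt =
  drop‿+<+ (subst₂ ℤ._<_ (sym (pos-* a (suc d))) (sym (pos-* b (suc c)))
    (/-<⇒*-< (+ a) (+ b) c d lt))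

2[1+m]²≤s[2+m]⇒2m<s : ∀ m s →
  2 ℕ.* suc m ℕ.* suc m ℕ.≤ s ℕ.* suc (suc m) → 2 ℕ.* m ℕ.< s
2[1+m]²≤s[2+m]⇒2m<s m s le = *-cancelʳ-< (suc (suc m)) (2 ℕ.* m) s (begin-strict
  2 ℕ.* m ℕ.* suc (suc m)        <⟨ m<n+m _ (ℕ.s≤s ℕ.z≤n) ⟩
  2 ℕ.+ 2 ℕ.* m ℕ.* suc (suc m)  ≡⟨ identity m ⟩
  2 ℕ.* suc m ℕ.* suc m          ≤⟨ le ⟩
  s ℕ.* suc (suc m)              ∎)
  where
  identity : ∀ m → 2 ℕ.+ 2 ℕ.* m ℕ.* suc (suc m) ≡ 2 ℕ.* suc m ℕ.* suc m
  identity = solve-∀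

s[2+m]<[3+2m][1+m]⇒s<2+2m : ∀ m s →
  s ℕ.* suc (suc m) ℕ.< (2 ℕ.* suc m ℕ.+ 1) ℕ.* suc m → s ℕ.< 2 ℕ.+ 2 ℕ.* m
s[2+m]<[3+2m][1+m]⇒s<2+2m m s lt = *-cancelʳ-< (suc (suc m)) s (2 ℕ.+ 2 ℕ.* m) (begin-strict
  s ℕ.* suc (suc m)                             <⟨ lt ⟩
  (2 ℕ.* suc m ℕ.+ 1) ℕ.* suc m                 ≤⟨ m≤m+n _ (suc m) ⟩
  (2 ℕ.* suc m ℕ.+ 1) ℕ.* suc m ℕ.+ suc m       ≡⟨ identity m ⟩
  (2 ℕ.+ 2 ℕ.* m) ℕ.* suc (suc m)               ∎)
  where
  identity : ∀ m → (2 ℕ.* suc m ℕ.+ 1) ℕ.* suc m ℕ.+ suc m ≡ (2 ℕ.+ 2 ℕ.* m) ℕ.* suc (suc m)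
  identity = solve-∀

lemma3 : (m : ℕ) →
    (+ (2 ℕ.* suc m)) / (suc (suc m)) ≤ (+ σ (suc m)) / (suc m) →
    (+ σ (suc m)) / (suc m) < (+ (2 ℕ.* suc m ℕ.+ 1)) / (suc (suc m)) →
    σ (suc m) ≡ 2 ℕ.* suc m ℕ.∸ 1
lemma3 m lower upper = begin-equality
  σ (suc m)        ≡⟨ ≤-antisym (ℕ.≤-pred σ<2+2m) 2m<σ ⟩
  suc (2 ℕ.* m)    ≡⟨ cong (ℕ._∸ 1) (sym (*-suc 2 m)) ⟩
  2 ℕ.* suc m ℕ.∸ 1 ∎
  where
  2m<σ : 2 ℕ.* m ℕ.< σ (suc m)
  2m<σ = 2[1+m]²≤s[2+m]⇒2m<s m (σ (suc m))
    (+/-≤⇒*-≤ (2 ℕ.* suc m) (σ (suc m)) (suc m) m lower)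
  σ<2+2m : σ (suc m) ℕ.< 2 ℕ.+ 2 ℕ.* m
  σ<2+2m = s[2+m]<[3+2m][1+m]⇒s<2+2m m (σ (suc m))
    (+/-<⇒*-< (σ (suc m)) (2 ℕ.* suc m ℕ.+ 1) m (suc m) upper)
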